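{- Let $R$ be a simple graph on vertex set $V$, let $B$ be its complement (on the same vertex set $V$), and let $W\subseteq V$. Let $a,b\in\mathbb{N}$ with $3\le a\le b\le 2a$. If $R[W]$ contains $K_{a,b}$ as a spanning subgraph with partite sets $X$ and $Y$ (where $|X|=a$, $|Y|=b$) such that $B[Y]$ is isomorphic to a subgraph of $K_a\boxplus K_{b-a}$, then $R[W]$ has a non-trivial good orientation.
   Context: $R[W]$, $B[Y]$ denote induced subgraphs. For positive integers $\ell\ge k$ (with $K_0$ the empty graph when $k=0$), $K_\ell\boxplus K_k$ is the disjoint union of the complete graphs $K_\ell$ and $K_k$ together with a set of edges matching every vertex of $K_k$ to a distinct vertex of $K_\ell$. An orientation $O_W$ of $R[W]$ is good if there is a partition of $W$ into two sets $U_1,V_1$ such that $d_{O_W}(x,y)\le 2$ (directed distance) whenever $x,y$ are both in $U_1$ or both in $V_1$; it is non-trivial good if moreover every vertex of $U_1$ has an in-neighbor and an out-neighbor in $V_1$ and every vertex of $V_1$ has an in-neighbor and an out-neighbor in $U_1$. -}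

module Defs where

open import Data.Nat using (ℕ; _≤_; _∸_)
open import Data.Bool using (Bool; true; false; not; _∧_; T)
open import Data.Fin using (Fin; toℕ; _≟_)
open import Data.Fin.Subset using (Subset; _∈_; _∉_; ∣_∣)
open import Data.Sum using (_⊎_; inj₁; inj₂)
open import Data.Product using (Σ; ∃; _×_; _,_)
open import Relation.Binary.PropositionalEquality using (_≡_; _≢_)
open import Relation.Nullary using (¬_)
open import Relation.Nullary.Decidable using (⌊_⌋)

record SimpleGraph (n : ℕ) : Set where
  field
    adj    : Fin n → Fin n → Bool
    sym    : ∀ x y → adj x y ≡ adj y x
    irrefl : ∀ x → adj x x ≡ false

open SimpleGraph public

Edge : ∀ {n} → SimpleGraph n → Fin n → Fin n → Set
Edge G x y = T (adj G x y)

complementAdj : ∀ {n} → SimpleGraph n → Fin n → Fin n → Bool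
complementAdj G x y = not (adj G x y) ∧ not ⌊ x ≟ y ⌋

-- Edges of K_ℓ ⊞ K_k on vertex set Fin ℓ ⊎ Fin k (intended k ≤ ℓ):
-- two cliques, plus vertex j of K_k matched to vertex j of K_ℓ.
BoxEdge : ∀ {ℓ k} → Fin ℓ ⊎ Fin k → Fin ℓ ⊎ Fin k → Set
BoxEdge (inj₁ i) (inj₁ j) = i ≢ j
BoxEdge (inj₂ i) (inj₂ j) = i ≢ j
BoxEdge (inj₁ i) (inj₂ j) = toℕ i ≡ toℕ j
BoxEdge (inj₂ j) (inj₁ i) = toℕ i ≡ toℕ j

IsPartition : ∀ {n} → Subset n → Subset n → Subset n → Set
IsPartition W P Q =
  (∀ v → v ∈ W → v ∈ P ⊎ v ∈ Q) ×
  (∀ v → v ∈ P → v ∈ W) × (∀ v → v ∈ Q → v ∈ W) ×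
  (∀ v → v ∈ P → v ∉ Q)

SpanningKab : ∀ {n} → SimpleGraph n → Subset n → ℕ → ℕ → Subset n → Subset n → Set
SpanningKab R W a b X Y =
  IsPartition W X Y × ∣ X ∣ ≡ a × ∣ Y ∣ ≡ b ×
  (∀ x y → x ∈ X → y ∈ Y → Edge R x y)

ComplementInducedSubgraphOfBox : ∀ {n} → SimpleGraph n → Subset n → ℕ → ℕ → Set
ComplementInducedSubgraphOfBox R Y ℓ k =
  Σ (Fin _ → Fin ℓ ⊎ Fin k) λ f →
    (∀ x y → x ∈ Y → y ∈ Y → f x ≡ f y → x ≡ y) ×
    (∀ x y → x ∈ Y → y ∈ Y → T (complementAdj R x y) → BoxEdge (f x) (f y))

-- O (O x y = true meaning arc x → y) is an orientation of R[W].
IsOrientation : ∀ {n} → SimpleGraph n → Subset n → (Fin n → Fin n → Bool) → Set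
IsOrientation R W O =
  (∀ x y → T (O x y) → x ∈ W × y ∈ W × Edge R x y) ×
  (∀ x y → x ∈ W → y ∈ W → Edge R x y → T (O x y) ⊎ T (O y x)) ×
  (∀ x y → ¬ (T (O x y) × T (O y x)))

Dist≤2 : ∀ {n} → (Fin n → Fin n → Bool) → Fin n → Fin n → Set
Dist≤2 O x y = x ≡ y ⊎ T (O x y) ⊎ ∃ λ z → T (O x z) × T (O z y)

Close : ∀ {n} → (Fin n → Fin n → Bool) → Subset n → Set
Close O P = ∀ x y → x ∈ P → y ∈ P → Dist≤2 O x y

InOutIn : ∀ {n} → (Fin n → Fin n → Bool) → Subset n → Subset n → Set
InOutIn O P Q = ∀ u → u ∈ P →
  (∃ λ v → v ∈ Q × T (O v u)) × (∃ λ v → v ∈ Q × T (O u v))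

NonTrivialGoodOrientation : ∀ {n} → SimpleGraph n → Subset n → (Fin n → Fin n → Bool) → Set
NonTrivialGoodOrientation R W O =
  IsOrientation R W O ×
  Σ (Subset _) λ U₁ → Σ (Subset _) λ V₁ →
    IsPartition W U₁ V₁ × Close O U₁ × Close O V₁ ×
    InOutIn O U₁ V₁ × InOutIn O V₁ U₁

-- Write c = b − a ≤ a, index X as {x_r : r < a}, and let f embed B[Y] into K_a ⊞ K_c;
-- as |Y| = a + c and f is injective, every vertex of K_a is some f y. Regard x_r as a
-- copy of vertex r of K_a: orient x_r → y when inj₁ r is adjacent to f y in K_a ⊞ K_c
-- and y → x_r otherwise, orient y → y′ when f y ∈ K_a and f y′ ∈ K_c are not matched
-- (such a pair is not a B-edge, hence an R-edge), and orient the remaining edges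
-- arbitrarily. Take U₁ = X and V₁ = Y. Two vertices of X are joined through the copy
-- of K_a inside Y, and two vertices of Y through a suitable x_r; finding x_r, and the
-- in- and out-neighbours on the other side, only needs a ≥ 3 (to avoid two labels)
-- and c ≤ a (so every vertex of K_c has a partner x_r).
module Submission where

open import Defs
open import Data.Nat using (ℕ; _≤_; _∸_; _*_)
open import Data.Bool using (Bool)
open import Data.Fin using (Fin)
open import Data.Fin.Subset using (Subset)
open import Data.Product using (Σ; _×_)

open import Data.Nat using (suc; _+_; _<_; s≤s)
import Data.Nat as ℕ
open import Data.Nat.Properties
  using (<-cmp; <-asym; ≤-trans; ≤-reflexive; ∸-monoˡ-≤; m+n∸m≡n; +-identityʳ; m+[n∸m]≡n)
open import Data.Fin using (zero; suc; toℕ; inject≤; join; splitAt; punchOut; _≟_)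
open import Data.Fin.Properties
  using (suc-injective; toℕ-injective; 0≢1+n; punchOut-injective; toℕ-inject≤; splitAt-join)
open import Data.Fin.Subset using (_∈_; ∣_∣; inside; outside)
open import Data.Fin.Subset.Properties using (_∈?_)
open import Data.Vec using (_∷_; []; here; there)
open import Data.Bool using (true; false; _∨_; T)
open import Data.Bool.Properties using (T-∨; T?)
open import Data.Sum using (_⊎_; inj₁; inj₂; map₂)
open import Data.Product using (∃; _,_)
open import Data.Empty using (⊥; ⊥-elim)
open import Data.Unit using (tt)
open import Function using (_∘_; Equivalence)
open import Relation.Binary.PropositionalEquality
  using (_≡_; _≢_; refl; trans; cong; subst; subst₂; ≢-sym)
import Relation.Binary.PropositionalEquality as ≡
open import Relation.Binary using (Tri; tri<; tri≈; tri>)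
open import Relation.Nullary using (¬_; Dec; yes; no; map′; ¬?)
open import Relation.Nullary.Decidable using (⌊_⌋; toWitness; fromWitness; _×-dec_)

∈-irrelevant : ∀ {n} {x : Fin n} {P : Subset n} (p q : x ∈ P) → p ≡ q
∈-irrelevant here      here      = refl
∈-irrelevant (there p) (there q) = cong there (∈-irrelevant p q)

InjectiveOn : ∀ {n} {A : Set} (P : Subset n) → (∀ {x} → x ∈ P → A) → Set
InjectiveOn P h = ∀ {x y} (p : x ∈ P) (q : y ∈ P) → h p ≡ h q → x ≡ y

index : ∀ {n} {x : Fin n} (P : Subset n) → x ∈ P → Fin ∣ P ∣
index (inside  ∷ P) here      = zero
index (inside  ∷ P) (there p) = suc (index P p)
index (outside ∷ P) (there p) = index P p

index-injective : ∀ {n} (P : Subset n) → InjectiveOn P (index P)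
index-injective (inside  ∷ P) here      here      _ = refl
index-injective (inside  ∷ P) (there p) (there q) e =
  cong suc (index-injective P p q (suc-injective e))
index-injective (outside ∷ P) (there p) (there q) e =
  cong suc (index-injective P p q e)

injectiveOn⇒surjective : ∀ {n k} (P : Subset n) (h : ∀ {x} → x ∈ P → Fin k) →
  ∣ P ∣ ≡ k → InjectiveOn P h → ∀ i → ∃ λ x → Σ (x ∈ P) λ p → h p ≡ i
injectiveOn⇒surjective [] h refl inj ()
injectiveOn⇒surjective (outside ∷ P) h ∣P∣≡k inj i =
  let x , p , e = injectiveOn⇒surjective P (h ∘ there) ∣P∣≡k
                    (λ p q → suc-injective ∘ inj (there p) (there q)) i
  in  suc x , there p , e
injectiveOn⇒surjective (inside ∷ P) h refl inj i with h here ≟ i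
... | yes h₀≡i = zero , here , h₀≡i
... | no  h₀≢i =
  let x , p , e = injectiveOn⇒surjective P h′ refl h′-injective (punchOut h₀≢i)
  in  suc x , there p , punchOut-injective (h₀≢h p) h₀≢i e
  where
  h₀≢h : ∀ {x} (p : x ∈ P) → h here ≢ h (there p)
  h₀≢h p = 0≢1+n ∘ inj here (there p)
  h′ : ∀ {x} → x ∈ P → Fin ∣ P ∣
  h′ p = punchOut (h₀≢h p)
  h′-injective : InjectiveOn P h′
  h′-injective p q =
    suc-injective ∘ inj (there p) (there q) ∘ punchOut-injective (h₀≢h p) (h₀≢h q)

edge-or-complement : ∀ {n} (G : SimpleGraph n) {x y} → x ≢ y →
  Edge G x y ⊎ T (complementAdj G x y)
edge-or-complement G {x} {y} x≢y with adj G x y | x ≟ y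
... | true  | _      = inj₁ tt
... | false | yes e  = ⊥-elim (x≢y e)
... | false | no  _  = inj₂ tt

module _ {n} {D O : Fin n → Fin n → Bool} (D⊆O : ∀ {x y} → T (D x y) → T (O x y)) where

  Close-mono : ∀ {P} → Close D P → Close O P
  Close-mono close x y p q with close x y p q
  ... | inj₁ x≡y                  = inj₁ x≡y
  ... | inj₂ (inj₁ xy)            = inj₂ (inj₁ (D⊆O xy))
  ... | inj₂ (inj₂ (z , xz , zy)) = inj₂ (inj₂ (z , D⊆O xz , D⊆O zy))

  InOutIn-mono : ∀ {P Q} → InOutIn D P Q → InOutIn O P Q
  InOutIn-mono inOut u p =
    let (v , q , vu) , (w , r , uw) = inOut u p
    in  (v , q , D⊆O vu) , (w , r , D⊆O uw)

extendOrientation : ∀ {n} (G : SimpleGraph n) (W : Subset n) (D : Fin n → Fin n → Bool) →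
  (∀ x y → T (D x y) → x ∈ W × y ∈ W × Edge G x y) →
  (∀ x y → T (D x y) → T (D y x) → ⊥) →
  Σ (Fin n → Fin n → Bool) λ O → IsOrientation G W O × (∀ {x y} → T (D x y) → T (O x y))
extendOrientation {n} G W D D-sound D-asym = O , (O-sound , O-total , O-asym) , D⊆O
  where
  Fallback : Fin n → Fin n → Set
  Fallback x y = x ∈ W × y ∈ W × Edge G x y × ¬ T (D y x) × toℕ x < toℕ y

  fallback? : ∀ x y → Dec (Fallback x y)
  fallback? x y =
    x ∈? W ×-dec y ∈? W ×-dec T? (adj G x y) ×-dec ¬? (T? (D y x)) ×-dec toℕ x ℕ.<? toℕ y

  O : Fin n → Fin n → Bool
  O x y = D x y ∨ ⌊ fallback? x y ⌋

  D⊆O : ∀ {x y} → T (D x y) → T (O x y)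
  D⊆O {x} {y} = Equivalence.from (T-∨ {D x y}) ∘ inj₁

  fallback⇒O : ∀ {x y} → Fallback x y → T (O x y)
  fallback⇒O {x} {y} = Equivalence.from (T-∨ {D x y}) ∘ inj₂ ∘ fromWitness

  O-cases : ∀ {x y} → T (O x y) → T (D x y) ⊎ Fallback x y
  O-cases {x} {y} t = map₂ toWitness (Equivalence.to (T-∨ {D x y}) t)

  O-sound : ∀ x y → T (O x y) → x ∈ W × y ∈ W × Edge G x y
  O-sound x y t with O-cases t
  ... | inj₁ d                 = D-sound x y d
  ... | inj₂ (xW , yW , e , _) = xW , yW , e

  O-total : ∀ x y → x ∈ W → y ∈ W → Edge G x y → T (O x y) ⊎ T (O y x)
  O-total x y xW yW e = by-cases (T? (D x y)) (T? (D y x)) (<-cmp (toℕ x) (toℕ y))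
    where
    by-cases : Dec (T (D x y)) → Dec (T (D y x)) →
      Tri (toℕ x < toℕ y) (toℕ x ≡ toℕ y) (toℕ y < toℕ x) → T (O x y) ⊎ T (O y x)
    by-cases (yes d) _       _              = inj₁ (D⊆O d)
    by-cases (no _)  (yes d) _              = inj₂ (D⊆O d)
    by-cases (no _)  (no ¬d) (tri< x<y _ _) = inj₁ (fallback⇒O (xW , yW , e , ¬d , x<y))
    by-cases (no ¬d) (no _)  (tri> _ _ y<x) =
      inj₂ (fallback⇒O (yW , xW , subst T (SimpleGraph.sym G x y) e , ¬d , y<x))
    by-cases (no _)  (no _)  (tri≈ _ x≡y _) with refl ← toℕ-injective x≡y =
      ⊥-elim (subst T (irrefl G x) e)

  O-asym : ∀ x y → ¬ (T (O x y) × T (O y x))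
  O-asym x y (t , u) with O-cases t | O-cases u
  ... | inj₁ d                     | inj₁ d′                   = D-asym x y d d′
  ... | inj₁ d                     | inj₂ (_ , _ , _ , ¬d , _) = ¬d d
  ... | inj₂ (_ , _ , _ , ¬d , _)  | inj₁ d                    = ¬d d
  ... | inj₂ (_ , _ , _ , _ , x<y) | inj₂ (_ , _ , _ , _ , y<x) = <-asym x<y y<x

avoid-two : ∀ {a} → 3 ≤ a → ∀ m n → ∃ λ (r : Fin a) → toℕ r ≢ m × toℕ r ≢ n
avoid-two (s≤s (s≤s (s≤s _))) = pick
  where
  pick : ∀ m n → ∃ λ r → toℕ r ≢ m × toℕ r ≢ n
  pick 0             0             = suc zero       , (λ ()) , (λ ())
  pick 0             1             = suc (suc zero) , (λ ()) , (λ ())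
  pick 0             (suc (suc _)) = suc zero       , (λ ()) , (λ ())
  pick 1             0             = suc (suc zero) , (λ ()) , (λ ())
  pick (suc (suc _)) 0             = suc zero       , (λ ()) , (λ ())
  pick (suc _)       (suc _)       = zero           , (λ ()) , (λ ())

boxEdge? : ∀ {ℓ k} (u v : Fin ℓ ⊎ Fin k) → Dec (BoxEdge u v)
boxEdge? (inj₁ i) (inj₁ j) = ¬? (i ≟ j)
boxEdge? (inj₂ i) (inj₂ j) = ¬? (i ≟ j)
boxEdge? (inj₁ i) (inj₂ j) = toℕ i ℕ.≟ toℕ j
boxEdge? (inj₂ j) (inj₁ i) = toℕ i ℕ.≟ toℕ j

data Role (a c : ℕ) : Set where
  inX  : Fin a → Role a c
  inY  : Fin a ⊎ Fin c → Role a c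
  none : Role a c

module _ {a c : ℕ} where

  data Arc : Role a c → Role a c → Set where
    X⟶Y   : ∀ {r u} → BoxEdge (inj₁ r) u → Arc (inX r) (inY u)
    Y⟶X   : ∀ {r u} → ¬ BoxEdge (inj₁ r) u → Arc (inY u) (inX r)
    Ka⟶Kc : ∀ {i j} → ¬ BoxEdge (inj₁ i) (inj₂ j) → Arc (inY (inj₁ i)) (inY (inj₂ j))

  arc? : ∀ ρ σ → Dec (Arc ρ σ)
  arc? (inX r)        (inY u)        = map′ X⟶Y (λ { (X⟶Y e) → e }) (boxEdge? (inj₁ r) u)
  arc? (inY u)        (inX r)        = map′ Y⟶X (λ { (Y⟶X e) → e }) (¬? (boxEdge? (inj₁ r) u))
  arc? (inY (inj₁ i)) (inY (inj₂ j)) =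
    map′ Ka⟶Kc (λ { (Ka⟶Kc e) → e }) (¬? (boxEdge? (inj₁ i) (inj₂ j)))
  arc? (inY (inj₁ _)) (inY (inj₁ _)) = no λ ()
  arc? (inY (inj₂ _)) (inY _)        = no λ ()
  arc? (inX _)        (inX _)        = no λ ()
  arc? (inX _)        none           = no λ ()
  arc? (inY _)        none           = no λ ()
  arc? none           _              = no λ ()

  arc-asym : ∀ {ρ σ} → Arc ρ σ → Arc σ ρ → ⊥
  arc-asym (X⟶Y e)    (Y⟶X ¬e) = ¬e e
  arc-asym (Y⟶X ¬e)   (X⟶Y e)  = ¬e e
  arc-asym (Ka⟶Kc _)  ()

  inX-in : ∀ r → Arc (inY (inj₁ r)) (inX r)
  inX-in r = Y⟶X λ r≢r → r≢r refl

  module _ (3≤a : 3 ≤ a) (c≤a : c ≤ a) where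

    inX-out : ∀ r → ∃ λ i → Arc (inX r) (inY (inj₁ i))
    inX-out r = let i , i≢r , _ = avoid-two 3≤a (toℕ r) (toℕ r)
                in  i , X⟶Y (≢-sym (i≢r ∘ cong toℕ))

    inY-in : ∀ u → ∃ λ r → Arc (inX r) (inY u)
    inY-in (inj₁ i) = let r , r≢i , _ = avoid-two 3≤a (toℕ i) (toℕ i)
                      in  r , X⟶Y (r≢i ∘ cong toℕ)
    inY-in (inj₂ j) = inject≤ j c≤a , X⟶Y (toℕ-inject≤ j c≤a)

    inY-out : ∀ u → ∃ λ r → Arc (inY u) (inX r)
    inY-out (inj₁ i) = i , inX-in i
    inY-out (inj₂ j) = let r , r≢j , _ = avoid-two 3≤a (toℕ j) (toℕ j)
                       in  r , Y⟶X r≢j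

    inY-close : ∀ {u v} → u ≢ v →
      Arc (inY u) (inY v) ⊎ ∃ λ r → Arc (inY u) (inX r) × Arc (inX r) (inY v)
    inY-close {inj₁ i} {inj₁ i′} u≢v = inj₂ (i , inX-in i , X⟶Y (u≢v ∘ cong inj₁))
    inY-close {inj₂ j} {inj₂ j′} u≢v =
      inj₂ (inject≤ j′ c≤a , Y⟶X j′≢j , X⟶Y (toℕ-inject≤ j′ c≤a))
      where
      j′≢j : toℕ (inject≤ j′ c≤a) ≢ toℕ j
      j′≢j e = u≢v (cong inj₂ (toℕ-injective (trans (≡.sym e) (toℕ-inject≤ j′ c≤a))))
    inY-close {inj₁ i} {inj₂ j} _ with boxEdge? (inj₁ i) (inj₂ j)
    ... | yes i~j = inj₂ (i , inX-in i , X⟶Y i~j)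
    ... | no  i≁j = inj₁ (Ka⟶Kc i≁j)
    inY-close {inj₂ j} {inj₁ i} _ =
      let r , r≢j , r≢i = avoid-two 3≤a (toℕ j) (toℕ i)
      in  inj₂ (r , Y⟶X r≢j , X⟶Y (r≢i ∘ cong toℕ))

module KabOrientation {n} (R : SimpleGraph n) (W X Y : Subset n) {c : ℕ}
  (3≤∣X∣ : 3 ≤ ∣ X ∣) (c≤∣X∣ : c ≤ ∣ X ∣)
  (part : IsPartition W X Y) (∣Y∣≡∣X∣+c : ∣ Y ∣ ≡ ∣ X ∣ + c)
  (complete : ∀ x y → x ∈ X → y ∈ Y → Edge R x y)
  (f : Fin n → Fin ∣ X ∣ ⊎ Fin c)
  (f-injective : ∀ x y → x ∈ Y → y ∈ Y → f x ≡ f y → x ≡ y)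
  (f-box : ∀ x y → x ∈ Y → y ∈ Y → T (complementAdj R x y) → BoxEdge (f x) (f y))
  where

  private
    a : ℕ
    a = ∣ X ∣

    X⊆W : ∀ {x} → x ∈ X → x ∈ W
    X⊆W = let _ , X⊆W , _ = part in X⊆W _

    Y⊆W : ∀ {y} → y ∈ Y → y ∈ W
    Y⊆W = let _ , _ , Y⊆W , _ = part in Y⊆W _

    X-Y-disjoint : ∀ {x} → x ∈ X → x ∈ Y → ⊥
    X-Y-disjoint = let _ , _ , _ , disjoint = part in disjoint _

  index-surjective : ∀ r → ∃ λ x → Σ (x ∈ X) λ p → index X p ≡ r
  index-surjective = injectiveOn⇒surjective X (index X) refl (index-injective X)

  f-hits-Ka : ∀ i → ∃ λ y → y ∈ Y × f y ≡ inj₁ i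
  f-hits-Ka i =
    let y , p , e = injectiveOn⇒surjective Y (λ {y} _ → join a c (f y)) ∣Y∣≡∣X∣+c
                      (λ p q → f-injective _ _ p q ∘ join-injective) (join a c (inj₁ i))
    in  y , p , join-injective e
    where
    join-injective : ∀ {u v} → join a c u ≡ join a c v → u ≡ v
    join-injective {u} {v} e =
      trans (≡.sym (splitAt-join a c u)) (trans (cong (splitAt a) e) (splitAt-join a c v))

  role : Fin n → Role a c
  role x with x ∈? X | x ∈? Y
  ... | yes p | _     = inX (index X p)
  ... | no _  | yes _ = inY (f x)
  ... | no _  | no _  = none

  data RoleView (x : Fin n) : Role a c → Set where
    viewX    : (p : x ∈ X) → RoleView x (inX (index X p))
    viewY    : ∀ {u} → x ∈ Y → f x ≡ u → RoleView x (inY u)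
    viewNone : RoleView x none

  roleView : ∀ x → RoleView x (role x)
  roleView x with x ∈? X | x ∈? Y
  ... | yes p | _     = viewX p
  ... | no _  | yes q = viewY q refl
  ... | no _  | no _  = viewNone

  role-X : ∀ {x} (p : x ∈ X) → role x ≡ inX (index X p)
  role-X {x} p with x ∈? X
  ... | yes q = cong (inX ∘ index X) (∈-irrelevant q p)
  ... | no ¬p = ⊥-elim (¬p p)

  role-Y : ∀ {y} → y ∈ Y → role y ≡ inY (f y)
  role-Y {y} q with y ∈? X | y ∈? Y
  ... | yes p | _     = ⊥-elim (X-Y-disjoint p q)
  ... | no _  | yes _ = refl
  ... | no _  | no ¬q = ⊥-elim (¬q q)

  vertex-inX : ∀ r → ∃ λ x → x ∈ X × role x ≡ inX r
  vertex-inX r = let x , p , e = index-surjective r in x , p , trans (role-X p) (cong inX e)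

  vertex-inKa : ∀ i → ∃ λ y → y ∈ Y × role y ≡ inY (inj₁ i)
  vertex-inKa i = let y , q , e = f-hits-Ka i in y , q , trans (role-Y q) (cong inY e)

  nonBox⇒edge : ∀ {y y′} → y ∈ Y → y′ ∈ Y → y ≢ y′ → ¬ BoxEdge (f y) (f y′) → Edge R y y′
  nonBox⇒edge q q′ y≢y′ ¬box with edge-or-complement R y≢y′
  ... | inj₁ e     = e
  ... | inj₂ nonE  = ⊥-elim (¬box (f-box _ _ q q′ nonE))

  arc-sound : ∀ {x y ρ σ} → RoleView x ρ → RoleView y σ → Arc ρ σ →
    x ∈ W × y ∈ W × Edge R x y
  arc-sound (viewX p)   (viewY q _)   (X⟶Y _) = X⊆W p , Y⊆W q , complete _ _ p q
  arc-sound (viewY q _) (viewX p)     (Y⟶X _) =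
    Y⊆W q , X⊆W p , subst T (SimpleGraph.sym R _ _) (complete _ _ p q)
  arc-sound (viewY q e) (viewY q′ e′) (Ka⟶Kc ¬box) =
    Y⊆W q , Y⊆W q′ , nonBox⇒edge q q′ y≢y′ (¬box ∘ subst₂ BoxEdge e e′)
    where
    y≢y′ : _ ≢ _
    y≢y′ refl with () ← trans (≡.sym e) e′
  arc-sound (viewX _)   (viewX _)   ()
  arc-sound (viewX _)   viewNone    ()
  arc-sound (viewY _ _) viewNone    ()
  arc-sound viewNone    _           ()

  kabArc : Fin n → Fin n → Bool
  kabArc x y = ⌊ arc? (role x) (role y) ⌋

  kabArc-sound : ∀ x y → T (kabArc x y) → x ∈ W × y ∈ W × Edge R x y
  kabArc-sound x y d = arc-sound (roleView x) (roleView y) (toWitness d)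

  kabArc-asym : ∀ x y → T (kabArc x y) → T (kabArc y x) → ⊥
  kabArc-asym x y d d′ = arc-asym (toWitness d) (toWitness d′)

  arc⇒kabArc : ∀ {x y ρ σ} → role x ≡ ρ → role y ≡ σ → Arc ρ σ → T (kabArc x y)
  arc⇒kabArc refl refl = fromWitness

  X-close : Close kabArc X
  X-close x x′ p p′ with x ≟ x′
  ... | yes x≡x′ = inj₁ x≡x′
  ... | no  x≢x′ =
    let y , _ , ry = vertex-inKa (index X p′)
    in  inj₂ (inj₂ (y , arc⇒kabArc (role-X p) ry (X⟶Y (x≢x′ ∘ index-injective X p p′))
                       , arc⇒kabArc ry (role-X p′) (inX-in (index X p′))))

  Y-close : Close kabArc Y
  Y-close y y′ q q′ with y ≟ y′
  ... | yes y≡y′ = inj₁ y≡y′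
  ... | no  y≢y′ with inY-close 3≤∣X∣ c≤∣X∣ (y≢y′ ∘ f-injective y y′ q q′)
  ... | inj₁ arc = inj₂ (inj₁ (arc⇒kabArc (role-Y q) (role-Y q′) arc))
  ... | inj₂ (r , in₁ , out₂) =
    let x , _ , rx = vertex-inX r
    in  inj₂ (inj₂ (x , arc⇒kabArc (role-Y q) rx in₁ , arc⇒kabArc rx (role-Y q′) out₂))

  X-inOut : InOutIn kabArc X Y
  X-inOut x p =
    let y , q , ry    = vertex-inKa (index X p)
        i , out       = inX-out 3≤∣X∣ c≤∣X∣ (index X p)
        y′ , q′ , ry′ = vertex-inKa i
    in  (y , q , arc⇒kabArc ry (role-X p) (inX-in (index X p))) ,
        (y′ , q′ , arc⇒kabArc (role-X p) ry′ out)

  Y-inOut : InOutIn kabArc Y X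
  Y-inOut y q =
    let r , inArc     = inY-in 3≤∣X∣ c≤∣X∣ (f y)
        x , p , rx    = vertex-inX r
        r′ , outArc   = inY-out 3≤∣X∣ c≤∣X∣ (f y)
        x′ , p′ , rx′ = vertex-inX r′
    in  (x , p , arc⇒kabArc rx (role-Y q) inArc) ,
        (x′ , p′ , arc⇒kabArc (role-Y q) rx′ outArc)

lemma2 : ∀ {n} (R : SimpleGraph n) (W : Subset n) (a b : ℕ) →
    3 ≤ a → a ≤ b → b ≤ 2 * a →
    (X Y : Subset n) → SpanningKab R W a b X Y →
    ComplementInducedSubgraphOfBox R Y a (b ∸ a) →
    Σ (Fin n → Fin n → Bool) λ O → NonTrivialGoodOrientation R W O
lemma2 R W a b 3≤a a≤b b≤2a X Y (part , refl , ∣Y∣≡b , complete) (f , f-injective , f-box) =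
  let O , isOrientation , D⊆O = extendOrientation R W kabArc kabArc-sound kabArc-asym
  in  O , isOrientation , X , Y , part ,
      Close-mono D⊆O X-close , Close-mono D⊆O Y-close ,
      InOutIn-mono D⊆O X-inOut , InOutIn-mono D⊆O Y-inOut
  where
  b∸a≤a : b ∸ a ≤ a
  b∸a≤a = ≤-trans (∸-monoˡ-≤ a b≤2a)
                  (≤-reflexive (trans (m+n∸m≡n a (a + 0)) (+-identityʳ a)))

  open KabOrientation R W X Y 3≤a b∸a≤a part (trans ∣Y∣≡b (≡.sym (m+[n∸m]≡n a≤b)))
         complete f f-injective f-box
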